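{- Let $\mathcal{P}=\{P_1,\dots,P_l\}$ with $P_i\subseteq\{0,1\}^{k_i}$, let $G'$ be a finite set with $|G'|=q$, and let $\phi:G'\to\{0,1\}$ satisfy $|\phi^{ -1}(1)|=1$. Let $P'_i:=\{(g_1,\dots,g_{k_i})\in (G')^{k_i}:(\phi(g_1),\dots,\phi(g_{k_i}))\in P_i\}$, and given an instance $(V,\mathcal{C})$ of Min-Ones($\mathcal{P}$), let $(V,\mathcal{C}')$ be the instance of CSP($\{P'_1,\dots,P'_l\}$) with the same variables (now ranging over $G'$) and the same constraint scopes, each predicate $P_i$ replaced by $P'_i$. For $\beta:S\to\{0,1\}$ let $\phi^{ -1}(\beta)=\{\alpha:S\to G' : \phi(\alpha(v))=\beta(v)\ \forall v\in S\}$. Suppose $\{X'_S(\alpha)\}$ (resp. $\{V'_S(\alpha)\}$) is a solution to $t$ rounds of the Sherali-Adams (resp. Lasserre) hierarchy for $(V,\mathcal{C}')$ that satisfies every constraint. Then $\{X_S(\beta)\}_{|S|\le t,\beta:S\to\{0,1\}}$ with $X_S(\beta)=\sum_{\alpha\in\phi^{ -1}(\beta)}X'_S(\alpha)$ (resp. $\{V_S(\beta)\}$ with $V_S(\beta)=\sum_{\alpha\in\phi^{ -1}(\beta)}V'_S(\alpha)$) is a solution to $t$ rounds of the Sherali-Adams (resp. Lasserre) hierarchy for $(V,\mathcal{C})$ that satisfies every constraint. Moreover, if the solution for $(V,\mathcal{C}')$ is balanced, the obtained solution is $\frac1q$-biased.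
   Context: An instance of CSP($\mathcal{Q}$) for predicates $Q_i\subseteq A^{k_i}$ over a finite set $A$ has variables $V$ with values in $A$ and constraints each given by a predicate type and a tuple of distinct variables; an assignment satisfies a constraint iff the tuple of values lies in the predicate. Min-Ones($\mathcal{P}$) is CSP($\mathcal{P}$) over $\{0,1\}$ with the goal of minimizing the number of variables set to $1$ subject to satisfying all constraints. A $t$-local distribution is $\{X_S(\alpha)\in[0,1]\}$, $S\subseteq V$, $|S|\le t$, $\alpha:S\to A$, with $X_\emptyset=1$ and $\sum_{\beta:T\setminus S\to A}X_T(\alpha\circ\beta)=X_S(\alpha)$ for $S\subseteq T$, $|T|\le t$. A solution to $t$ rounds of Sherali-Adams is a $t$-local distribution; a solution to $t$ rounds of Lasserre is a family of real vectors $\{V_S(\alpha)\}_{|S|\le t}$ for which there is a $2t$-local distribution with $\langle V_S(\alpha),V_T(\beta)\rangle=X_{S\cup T}(\alpha\circ\beta)$ if $\alpha,\beta$ agree on $S\cap T$ and $0$ otherwise. A solution satisfies a constraint with scope $E$ and predicate $Q$ if $X_E(\alpha)=0$ for every $\alpha$ whose tuple of values is not in $Q$. It is balanced if $X_{\{v\}}(v\mapsto g)=1/|A|$ for all $v,g$; for $A=\{0,1\}$ it is $p$-biased if $X_{\{v\}}(v\mapsto1)=p$ for all $v$. -}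

module Defs where

open import Level using (Level; _⊔_)
open import Data.Nat as ℕ using (ℕ; zero; suc)
open import Data.Bool using (Bool; true; false; if_then_else_)
open import Data.Fin using (Fin; zero; suc)
open import Data.Fin.Properties using () renaming (_≟_ to _≟ᶠ_)
open import Data.Fin.Subset using (Subset; _⊆_; ∣_∣)
open import Data.Maybe using (Maybe; just; nothing; is-just; maybe)
open import Data.Vec using (Vec; []; _∷_; replicate; _[_]≔_; lookup; map)
open import Data.List using (List)
open import Data.List.Relation.Unary.All using (All)
open import Data.Product using (Σ; _×_; _,_)
open import Relation.Nullary using (¬_; yes; no; does)
open import Relation.Binary.PropositionalEquality using (_≡_)
open import Relation.Binary.Structures using (IsTotalOrder)
open import Algebra.Bundles using (CommutativeRing)

-- The scalars.  The paper works over the reals ℝ; agda-stdlib has no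
-- reals, so we work over an arbitrary ordered commutative ring (ℝ being
-- an instance).

record OrderedCommRing (c ℓ : Level) : Set (Level.suc (c ⊔ ℓ)) where
  field
    commutativeRing : CommutativeRing c ℓ
  open CommutativeRing commutativeRing public
  field
    _≤_          : Carrier → Carrier → Set ℓ
    isTotalOrder : IsTotalOrder _≈_ _≤_
    +-mono-≤     : ∀ {a b} (d : Carrier) → a ≤ b → (a + d) ≤ (b + d)
    *-nonneg     : ∀ {a b} → 0# ≤ a → 0# ≤ b → 0# ≤ (a * b)

-- A partial assignment α : S → A (S ⊆ V)
-- is a vector whose entry at v is  just (α v)  if v ∈ S and nothing
-- otherwise; so the pair (S , α) is encoded by one vector.
PA : Set → ℕ → Set
PA A n = Vec (Maybe A) n

dom : ∀ {A n} → PA A n → Subset n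
dom = map is-just

size : ∀ {A n} → PA A n → ℕ
size α = ∣ dom α ∣

emptyPA : ∀ {A} n → PA A n
emptyPA n = replicate n nothing

single : ∀ {A n} → Fin n → A → PA A n
single {n = n} v g = emptyPA n [ v ]≔ just g

assign : ∀ {A n k} → Vec (Fin n) k → Vec A k → PA A n
assign {n = n} []       []       = emptyPA n
assign         (e ∷ es) (a ∷ as) = assign es as [ e ]≔ just a

merge : ∀ {q n} → PA (Fin q) n → PA (Fin q) n → Maybe (PA (Fin q) n)
merge []              []              = just []
merge (x ∷ α)         (y ∷ β) with merge α β
... | nothing = nothing
... | just γ with x | y
...   | nothing | y'      = just (y' ∷ γ)
...   | just a  | nothing = just (just a ∷ γ)
...   | just a  | just b  with a ≟ᶠ b
...     | yes _ = just (just a ∷ γ)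
...     | no  _ = nothing

record PredFamily (A : Set) : Set₁ where
  constructor predFamily
  field
    l    : ℕ
    ar   : Fin l → ℕ
    pred : (i : Fin l) → Vec A (ar i) → Set

record Constraint (n l : ℕ) (ar : Fin l → ℕ) : Set where
  constructor constraint
  field
    type     : Fin l
    scope    : Vec (Fin n) (ar type)
    distinct : ∀ j j' → lookup scope j ≡ lookup scope j' → j ≡ j'

Instance : ∀ {A} → PredFamily A → ℕ → Set
Instance 𝒫 n = List (Constraint n (PredFamily.l 𝒫) (PredFamily.ar 𝒫))

𝔹 : Set
𝔹 = Fin 2

one : 𝔹
one = suc zero

liftFamily : ∀ {q} → (Fin q → 𝔹) → PredFamily 𝔹 → PredFamily (Fin q)
PredFamily.l    (liftFamily φ 𝒫)      = PredFamily.l 𝒫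
PredFamily.ar   (liftFamily φ 𝒫)      = PredFamily.ar 𝒫
PredFamily.pred (liftFamily φ 𝒫) i gs = PredFamily.pred 𝒫 i (map φ gs)

UniqueOne : ∀ {q} → (Fin q → 𝔹) → Set
UniqueOne {q} φ = Σ (Fin q) λ g → (φ g ≡ one) × (∀ g' → φ g' ≡ one → g' ≡ g)

module Hier {c ℓ : Level} (𝓡 : OrderedCommRing c ℓ) where
  open OrderedCommRing 𝓡 using (Carrier; _≈_; _+_; _*_; 0#; 1#; _≤_)

  ΣFin : ∀ q → (Fin q → Carrier) → Carrier
  ΣFin zero    f = 0#
  ΣFin (suc q) f = f zero + ΣFin q (λ g → f (suc g))

  natR : ℕ → Carrier
  natR zero    = 0#
  natR (suc m) = 1# + natR m

  -- For α : S → A and T ⊇ S:  Σ_{β : T∖S → A} f(α ∘ β)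
  sumExt : ∀ {q n} → (PA (Fin q) n → Carrier) → PA (Fin q) n → Subset n → Carrier
  sumExt         f []            []          = f []
  sumExt         f (just g ∷ α)  (_ ∷ T)     = sumExt (λ γ → f (just g ∷ γ)) α T
  sumExt         f (nothing ∷ α) (false ∷ T) = sumExt (λ γ → f (nothing ∷ γ)) α T
  sumExt {q = q} f (nothing ∷ α) (true ∷ T)  =
    ΣFin q (λ g → sumExt (λ γ → f (just g ∷ γ)) α T)

  record LocalDist (a n t : ℕ) (X : PA (Fin a) n → Carrier) : Set (c ⊔ ℓ) where
    field
      empty   : X (emptyPA n) ≈ 1#
      range   : ∀ α → size α ℕ.≤ t → (0# ≤ X α) × (X α ≤ 1#)
      consist : ∀ (α : PA (Fin a) n) (T : Subset n) → dom α ⊆ T → ∣ T ∣ ℕ.≤ t →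
                sumExt X α T ≈ X α

  Satisfies : ∀ {a n} (𝒫 : PredFamily (Fin a)) → (PA (Fin a) n → Carrier) →
              Constraint n (PredFamily.l 𝒫) (PredFamily.ar 𝒫) → Set ℓ
  Satisfies 𝒫 X (constraint i E _) =
    ∀ vals → ¬ PredFamily.pred 𝒫 i vals → X (assign E vals) ≈ 0#

  SatisfiesAll : ∀ {a n} (𝒫 : PredFamily (Fin a)) → (PA (Fin a) n → Carrier) →
                 Instance 𝒫 n → Set ℓ
  SatisfiesAll 𝒫 X 𝒞 = All (Satisfies 𝒫 X) 𝒞

  SASolution : ∀ {a n} (𝒫 : PredFamily (Fin a)) → Instance 𝒫 n → ℕ →
               (PA (Fin a) n → Carrier) → Set (c ⊔ ℓ)
  SASolution {a} {n} 𝒫 𝒞 t X = LocalDist a n t X × SatisfiesAll 𝒫 X 𝒞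

  _·_ : ∀ {N} → (Fin N → Carrier) → (Fin N → Carrier) → Carrier
  _·_ {N} u w = ΣFin N (λ i → u i * w i)

  -- ⟨V_S(α), V_T(β)⟩ = X_{S∪T}(α∘β) if α, β agree on S ∩ T, and 0 otherwise
  Gram : ∀ {a n N} → ℕ → (PA (Fin a) n → (Fin N → Carrier)) →
         (PA (Fin a) n → Carrier) → Set ℓ
  Gram t V X = ∀ α β → size α ℕ.≤ t → size β ℕ.≤ t →
    (V α · V β) ≈ (maybe X 0# (merge α β))

  -- solution to t rounds of Lasserre (vectors V, with its 2t-local
  -- distribution X) satisfying every constraint
  LasserreSolution : ∀ {a n N} (𝒫 : PredFamily (Fin a)) → Instance 𝒫 n → ℕ →
                     (PA (Fin a) n → (Fin N → Carrier)) →
                     (PA (Fin a) n → Carrier) → Set (c ⊔ ℓ)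
  LasserreSolution {a} {n} 𝒫 𝒞 t V X =
    LocalDist a n (t ℕ.+ t) X × Gram t V X × SatisfiesAll 𝒫 X 𝒞

  -- balanced: X_{v}(v ↦ g) = 1/a, written a · X_{v}(v ↦ g) = 1
  Balanced : ∀ {a n} → (PA (Fin a) n → Carrier) → Set ℓ
  Balanced {a} X = ∀ v g → (natR a * X (single v g)) ≈ 1#

  -- (1/q)-biased: X_{v}(v ↦ 1) = 1/q, written q · X_{v}(v ↦ 1) = 1
  InvBiased : ∀ {n} → ℕ → (PA 𝔹 n → Carrier) → Set ℓ
  InvBiased q X = ∀ v → (natR q * X (single v one)) ≈ 1#

  -- Σ_{α ∈ φ⁻¹(β)} f(α), where φ⁻¹(β) = {α : S → G' | φ(α v) = β v ∀ v ∈ S}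
  sumPre : ∀ {q n} → (Fin q → 𝔹) → (PA (Fin q) n → Carrier) → PA 𝔹 n → Carrier
  sumPre         φ f []             = f []
  sumPre         φ f (nothing ∷ β)  = sumPre φ (λ α → f (nothing ∷ α)) β
  sumPre {q = q} φ f (just b ∷ β)   =
    ΣFin q (λ g → if does (φ g ≟ᶠ b) then sumPre φ (λ α → f (just g ∷ α)) β else 0#)

  pushX : ∀ {q n} → (Fin q → 𝔹) → (PA (Fin q) n → Carrier) → PA 𝔹 n → Carrier
  pushX φ X' = sumPre φ X'

  pushV : ∀ {q n N} → (Fin q → 𝔹) → (PA (Fin q) n → (Fin N → Carrier)) →
          PA 𝔹 n → (Fin N → Carrier)
  pushV φ V' β i = sumPre φ (λ α → V' α i) β

-- X_S(β) sums X' over the fibre φ⁻¹(β), a linear operation on functions of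
-- assignments.  It commutes with marginalisation, so consistency transfers; it
-- preserves nonnegativity, and as the fibre of β is part of all assignments on dom β,
-- it is bounded by the total mass 1.  The Gram identities transfer because two
-- preimages merge to a preimage of the merge, while preimages of different values
-- never merge.  A constraint of 𝒫 violated by β is violated by each preimage, which is
-- an assignment of the lifted family on the same scope.  Finally φ⁻¹(1) = {g₁} gives
-- X_{v}(v ↦ 1) = X'_{v}(v ↦ g₁).
module Submission where

open import Defs
open import Level using (Level)
open import Function using (_∘_)
open import Data.Nat using (ℕ; zero; suc)
import Data.Nat as ℕ
open import Data.Bool using (true; false; if_then_else_)
open import Data.Fin using (Fin; zero; suc)
open import Data.Fin.Properties using (suc-injective; 0≢1+n) renaming (_≟_ to _≟ᶠ_)
open import Data.Fin.Subset using (Subset; _⊆_; ∣_∣)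
open import Data.Fin.Subset.Properties using (⊆-min)
open import Data.Maybe as Maybe using (Maybe; just; nothing; is-just; maybe′)
open import Data.Maybe.Properties using (just-injective)
open import Data.Vec using (Vec; []; _∷_; head; lookup; map; tabulate)
open import Data.Vec.Properties
  using (lookup-map; lookup-replicate; lookup∘update; lookup∘update′; map-replicate;
         lookup∘tabulate; tabulate∘lookup; tabulate-∘; tabulate-cong)
open import Data.Vec.Relation.Unary.Any using (here; there; index)
open import Data.Vec.Relation.Unary.Any.Properties using (lookup-index)
open import Data.Vec.Membership.Propositional using (_∉_)
open import Data.Vec.Relation.Binary.Pointwise.Extensional using (ext; Pointwise-≡⇒≡)
open import Data.List.Relation.Unary.All as All using ()
open import Data.Product using (Σ; _×_; _,_; proj₁; proj₂)
open import Data.Empty using (⊥-elim)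
open import Relation.Nullary using (yes; no; does; Dec)
open import Relation.Binary.Structures using (IsTotalOrder)
open import Relation.Binary.PropositionalEquality as ≡ using (_≡_; _≢_; refl; cong; subst)

relabel : ∀ {A B : Set} {n} → (A → B) → PA A n → PA B n
relabel f = map (Maybe.map f)

dom-relabel : ∀ {A B : Set} {n} (f : A → B) (α : PA A n) → dom (relabel f α) ≡ dom α
dom-relabel f []            = refl
dom-relabel f (just _ ∷ α)  = cong (true ∷_) (dom-relabel f α)
dom-relabel f (nothing ∷ α) = cong (false ∷_) (dom-relabel f α)

dom-fibre : ∀ {A B : Set} {n} (f : A → B) (α : PA A n) {β} →
            relabel f α ≡ β → dom α ≡ dom β
dom-fibre f α α↦β = ≡.trans (≡.sym (dom-relabel f α)) (cong dom α↦β)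

dom-emptyPA-⊆ : ∀ {A : Set} n (T : Subset n) → dom (emptyPA {A} n) ⊆ T
dom-emptyPA-⊆ n T = subst (_⊆ T) (≡.sym (map-replicate is-just nothing n)) (⊆-min T)

Distinct : ∀ {n k} → Vec (Fin n) k → Set
Distinct E = ∀ j j' → lookup E j ≡ lookup E j' → j ≡ j'

module _ {A : Set} {n : ℕ} where

  lookup-assign-∉ : ∀ {k} {E : Vec (Fin n) k} {v} → v ∉ E → (xs : Vec A k) →
                    lookup (assign E xs) v ≡ nothing
  lookup-assign-∉ {E = []}     {v} v∉E []       = lookup-replicate v nothing
  lookup-assign-∉ {E = e ∷ es} {v} v∉E (x ∷ xs) =
    ≡.trans (lookup∘update′ (v∉E ∘ here) (assign es xs) (just x))
            (lookup-assign-∉ (v∉E ∘ there) xs)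

  lookup-assign-∈ : ∀ {k} (E : Vec (Fin n) k) → Distinct E → (xs : Vec A k) (j : Fin k) →
                    lookup (assign E xs) (lookup E j) ≡ just (lookup xs j)
  lookup-assign-∈ (e ∷ es) _        (x ∷ xs) zero    = lookup∘update e (assign es xs) (just x)
  lookup-assign-∈ (e ∷ es) distinct (x ∷ xs) (suc j) =
    ≡.trans (lookup∘update′ (λ p → 0≢1+n (distinct zero (suc j) (≡.sym p)))
                            (assign es xs) (just x))
            (lookup-assign-∈ es (λ i i' p → suc-injective (distinct (suc i) (suc i') p)) xs j)

module _ {A B : Set} {f : A → B} where

  map-≡-just : ∀ (m : Maybe A) {b} → Maybe.map f m ≡ just b →
               Σ A λ a → m ≡ just a × f a ≡ b
  map-≡-just (just a) p = a , refl , just-injective p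

  map-≡-nothing : ∀ (m : Maybe A) → Maybe.map f m ≡ nothing → m ≡ nothing
  map-≡-nothing nothing _ = refl

module _ {A B : Set} {n k : ℕ} (f : A → B) (E : Vec (Fin n) k) (distinct : Distinct E)
         (α : PA A n) (bs : Vec B k) (α↦bs : relabel f α ≡ assign E bs) where

  private
    open import Data.Vec.Membership.DecPropositional (_≟ᶠ_ {n}) using (_∈?_)

    relabel-at : ∀ v → Maybe.map f (lookup α v) ≡ lookup (assign E bs) v
    relabel-at v =
      ≡.trans (≡.sym (lookup-map v (Maybe.map f) α)) (cong (λ γ → lookup γ v) α↦bs)

    onScope : ∀ j → Σ A λ a → lookup α (lookup E j) ≡ just a × f a ≡ lookup bs j
    onScope j = map-≡-just _ (≡.trans (relabel-at (lookup E j)) (lookup-assign-∈ E distinct bs j))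

    as : Vec A k
    as = tabulate (proj₁ ∘ onScope)

    α≗assign : ∀ v → lookup α v ≡ lookup (assign E as) v
    α≗assign v with v ∈? E
    ... | yes v∈E = subst (λ w → lookup α w ≡ lookup (assign E as) w)
                          (≡.sym (lookup-index v∈E)) (onE (index v∈E))
      where
      onE : ∀ j → lookup α (lookup E j) ≡ lookup (assign E as) (lookup E j)
      onE j = ≡.trans (proj₁ (proj₂ (onScope j)))
                      (≡.sym (≡.trans (lookup-assign-∈ E distinct as j)
                                      (cong just (lookup∘tabulate (proj₁ ∘ onScope) j))))
    ... | no v∉E = ≡.trans (map-≡-nothing _ (≡.trans (relabel-at v) (lookup-assign-∉ v∉E bs)))
                           (≡.sym (lookup-assign-∉ v∉E as))

  relabel≡assign : Σ (Vec A k) λ as → α ≡ assign E as × map f as ≡ bs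
  relabel≡assign = as , Pointwise-≡⇒≡ (ext α≗assign) , map-as
    where
    open ≡.≡-Reasoning
    map-as : map f as ≡ bs
    map-as = begin
      map f as                        ≡⟨ tabulate-∘ f (proj₁ ∘ onScope) ⟨
      tabulate (f ∘ proj₁ ∘ onScope)  ≡⟨ tabulate-cong (proj₂ ∘ proj₂ ∘ onScope) ⟩
      tabulate (lookup bs)            ≡⟨ tabulate∘lookup bs ⟩
      bs                              ∎

mergeHead : ∀ {r} → Maybe (Fin r) → Maybe (Fin r) → Maybe (Maybe (Fin r))
mergeHead nothing  y        = just y
mergeHead (just a) nothing  = just (just a)
mergeHead (just a) (just b) with a ≟ᶠ b
... | yes _ = just (just a)
... | no  _ = nothing

mergeHead-≡ : ∀ {r} (g : Fin r) → mergeHead (just g) (just g) ≡ just (just g)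
mergeHead-≡ g with g ≟ᶠ g
... | yes _   = refl
... | no  g≢g = ⊥-elim (g≢g refl)

mergeHead-≢ : ∀ {r} {g g' : Fin r} → g ≢ g' → mergeHead (just g) (just g') ≡ nothing
mergeHead-≢ {g = g} {g'} g≢g' with g ≟ᶠ g'
... | yes g≡g' = ⊥-elim (g≢g' g≡g')
... | no  _    = refl

maybe-merge-∷ : ∀ {b} {B : Set b} {r n} (F : PA (Fin r) (suc n) → B) (z : B) x y
                (α α' : PA (Fin r) n) →
  maybe′ F z (merge (x ∷ α) (y ∷ α')) ≡
  maybe′ (λ γ → maybe′ (λ w → F (w ∷ γ)) z (mergeHead x y)) z (merge α α')
maybe-merge-∷ F z x y α α' with merge α α'
... | nothing = refl
... | just γ with x | y
...   | nothing | _       = refl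
...   | just a  | nothing = refl
...   | just a  | just b with a ≟ᶠ b
...     | yes _ = refl
...     | no  _ = refl

module _ {c ℓ : Level} (𝓡 : OrderedCommRing c ℓ) where

  open OrderedCommRing 𝓡
    using (Carrier; _≈_; _+_; _*_; 0#; _≤_; isTotalOrder; setoid;
           semiring; +-cong; *-cong; +-comm; *-comm; +-identityˡ; +-identityʳ; zeroʳ)
    renaming (refl to ≈-refl; sym to ≈-sym; trans to ≈-trans; reflexive to ≈-reflexive;
              +-mono-≤ to +-monoˡ-≤)
  open IsTotalOrder isTotalOrder
    using (≲-respˡ-≈; ≲-respʳ-≈) renaming (refl to ≤-refl; trans to ≤-trans)
  open Hier 𝓡
  open import Algebra.Properties.Semiring.Sum semiring
    using (sum; sum-cong-≗; ∑-comm; *-distribˡ-sum)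
  open import Relation.Binary.Reasoning.Setoid setoid

  +-mono-≤ : ∀ {a b x y} → a ≤ b → x ≤ y → (a + x) ≤ (b + y)
  +-mono-≤ {a} {b} {x} {y} a≤b x≤y =
    ≤-trans (+-monoˡ-≤ x a≤b)
            (≲-respˡ-≈ (+-comm x b) (≲-respʳ-≈ (+-comm y b) (+-monoˡ-≤ b x≤y)))

  ΣFin-cong : ∀ q {f h : Fin q → Carrier} → (∀ g → f g ≈ h g) → ΣFin q f ≈ ΣFin q h
  ΣFin-cong zero    f≈h = ≈-refl
  ΣFin-cong (suc q) f≈h = +-cong (f≈h zero) (ΣFin-cong q (f≈h ∘ suc))

  ΣFin-zero : ∀ q {f : Fin q → Carrier} → (∀ g → f g ≈ 0#) → ΣFin q f ≈ 0#
  ΣFin-zero zero    f≈0 = ≈-refl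
  ΣFin-zero (suc q) f≈0 =
    ≈-trans (+-cong (f≈0 zero) (ΣFin-zero q (f≈0 ∘ suc))) (+-identityˡ 0#)

  ΣFin≡sum : ∀ q (f : Fin q → Carrier) → ΣFin q f ≡ sum f
  ΣFin≡sum zero    f = refl
  ΣFin≡sum (suc q) f = cong (f zero +_) (ΣFin≡sum q (f ∘ suc))

  *-ΣFin : ∀ q a (f : Fin q → Carrier) → a * ΣFin q f ≈ ΣFin q (λ g → a * f g)
  *-ΣFin q a f = begin
    a * ΣFin q f             ≡⟨ cong (a *_) (ΣFin≡sum q f) ⟩
    a * sum f                ≈⟨ *-distribˡ-sum a f ⟩
    sum (λ g → a * f g)      ≡⟨ ΣFin≡sum q _ ⟨
    ΣFin q (λ g → a * f g)   ∎

  ΣFin-comm : ∀ q r (f : Fin q → Fin r → Carrier) →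
              ΣFin q (λ g → ΣFin r (f g)) ≈ ΣFin r (λ k → ΣFin q (λ g → f g k))
  ΣFin-comm q r f = begin
    ΣFin q (λ g → ΣFin r (f g))          ≡⟨ ΣFin≡sum q _ ⟩
    sum (λ g → ΣFin r (f g))             ≡⟨ sum-cong-≗ (λ g → ΣFin≡sum r (f g)) ⟩
    sum (λ g → sum (f g))                ≈⟨ ∑-comm f ⟩
    sum (λ k → sum (λ g → f g k))        ≡⟨ sum-cong-≗ (λ k → ΣFin≡sum q (f′ k)) ⟨
    sum (λ k → ΣFin q (f′ k))            ≡⟨ ΣFin≡sum r _ ⟨
    ΣFin r (λ k → ΣFin q (λ g → f g k))  ∎
    where
    f′ : Fin r → Fin q → Carrier
    f′ k g = f g k

  ΣFin-nonneg : ∀ q {f : Fin q → Carrier} → (∀ g → 0# ≤ f g) → 0# ≤ ΣFin q f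
  ΣFin-nonneg zero    0≤f = ≤-refl
  ΣFin-nonneg (suc q) 0≤f =
    ≲-respˡ-≈ (+-identityˡ 0#) (+-mono-≤ (0≤f zero) (ΣFin-nonneg q (0≤f ∘ suc)))

  ΣFin-mono : ∀ q {f h : Fin q → Carrier} → (∀ g → f g ≤ h g) → ΣFin q f ≤ ΣFin q h
  ΣFin-mono zero    f≤h = ≤-refl
  ΣFin-mono (suc q) f≤h = +-mono-≤ (f≤h zero) (ΣFin-mono q (f≤h ∘ suc))

  ΣFin-single : ∀ q (g₀ : Fin q) {f : Fin q → Carrier} → (∀ g → g ≢ g₀ → f g ≈ 0#) →
                ΣFin q f ≈ f g₀
  ΣFin-single (suc q) zero     f≈0 =
    ≈-trans (+-cong ≈-refl (ΣFin-zero q (λ g → f≈0 (suc g) λ ()))) (+-identityʳ _)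
  ΣFin-single (suc q) (suc g₀) f≈0 =
    ≈-trans (+-cong (f≈0 zero λ ())
                    (ΣFin-single q g₀ (λ g g≢g₀ → f≈0 (suc g) (g≢g₀ ∘ suc-injective))))
            (+-identityˡ _)

  module _ {p} {P : Set p} where

    if-cong : ∀ (P? : Dec P) {x y} → (P → x ≈ y) →
              (if does P? then x else 0#) ≈ (if does P? then y else 0#)
    if-cong (yes p) x≈y = x≈y p
    if-cong (no  _) x≈y = ≈-refl

    if-zero : ∀ (P? : Dec P) {x} → (P → x ≈ 0#) → (if does P? then x else 0#) ≈ 0#
    if-zero (yes p) x≈0 = x≈0 p
    if-zero (no  _) x≈0 = ≈-refl

    if-yes : ∀ (P? : Dec P) {x} → P → (if does P? then x else 0#) ≈ x
    if-yes (yes _) _ = ≈-refl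
    if-yes (no ¬p) p = ⊥-elim (¬p p)

  if-ΣFin : ∀ b r (f : Fin r → Carrier) →
            (if b then ΣFin r f else 0#) ≈ ΣFin r (λ k → if b then f k else 0#)
  if-ΣFin true  r f = ≈-refl
  if-ΣFin false r f = ≈-sym (ΣFin-zero r (λ _ → ≈-refl))

  *-if : ∀ b a x → a * (if b then x else 0#) ≈ (if b then a * x else 0#)
  *-if true  a x = ≈-refl
  *-if false a x = zeroʳ a

  if-nonneg : ∀ b {x} → 0# ≤ x → 0# ≤ (if b then x else 0#)
  if-nonneg true  0≤x = 0≤x
  if-nonneg false 0≤x = ≤-refl

  if-≤ : ∀ b {x y} → x ≤ y → 0# ≤ y → (if b then x else 0#) ≤ y
  if-≤ true  x≤y 0≤y = x≤y
  if-≤ false x≤y 0≤y = 0≤y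

  module _ {q : ℕ} where

    sumExt-zero : ∀ {n} (α : PA (Fin q) n) T → sumExt (λ _ → 0#) α T ≈ 0#
    sumExt-zero []            []          = ≈-refl
    sumExt-zero (just _ ∷ α)  (_ ∷ T)     = sumExt-zero α T
    sumExt-zero (nothing ∷ α) (false ∷ T) = sumExt-zero α T
    sumExt-zero (nothing ∷ α) (true ∷ T)  = ΣFin-zero q (λ _ → sumExt-zero α T)

    sumExt-ΣFin : ∀ {n} r (f : Fin r → PA (Fin q) n → Carrier) (α : PA (Fin q) n) T →
                  sumExt (λ γ → ΣFin r (λ k → f k γ)) α T ≈
                  ΣFin r (λ k → sumExt (f k) α T)
    sumExt-ΣFin r f []            []          = ≈-refl
    sumExt-ΣFin r f (just _ ∷ α)  (_ ∷ T)     = sumExt-ΣFin r _ α T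
    sumExt-ΣFin r f (nothing ∷ α) (false ∷ T) = sumExt-ΣFin r _ α T
    sumExt-ΣFin r f (nothing ∷ α) (true ∷ T)  =
      ≈-trans (ΣFin-cong q (λ _ → sumExt-ΣFin r _ α T)) (ΣFin-comm q r _)

    sumExt-if : ∀ {n} b (f : PA (Fin q) n → Carrier) (α : PA (Fin q) n) T →
                sumExt (λ γ → if b then f γ else 0#) α T ≈ (if b then sumExt f α T else 0#)
    sumExt-if true  f α T = ≈-refl
    sumExt-if false f α T = sumExt-zero α T

    sumExt-nonneg : ∀ {n} {f : PA (Fin q) n → Carrier} (T : Subset n) →
                    (∀ γ → dom γ ≡ T → 0# ≤ f γ) → 0# ≤ sumExt f (emptyPA n) T
    sumExt-nonneg []          0≤f = 0≤f [] refl
    sumExt-nonneg (false ∷ T) 0≤f = sumExt-nonneg T (λ γ d → 0≤f _ (cong (false ∷_) d))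
    sumExt-nonneg (true ∷ T)  0≤f =
      ΣFin-nonneg q (λ _ → sumExt-nonneg T (λ γ d → 0≤f _ (cong (true ∷_) d)))

  maybe-cong : ∀ {A : Set} {F G : A → Carrier} (m : Maybe A) → (∀ a → F a ≈ G a) →
               maybe′ F 0# m ≈ maybe′ G 0# m
  maybe-cong nothing  F≈G = ≈-refl
  maybe-cong (just a) F≈G = F≈G a

  module _ {q : ℕ} (φ : Fin q → 𝔹) where

    sumPre-cong-fibre : ∀ {n} {f h : PA (Fin q) n → Carrier} (β : PA 𝔹 n) →
                        (∀ α → relabel φ α ≡ β → f α ≈ h α) →
                        sumPre φ f β ≈ sumPre φ h β
    sumPre-cong-fibre []            f≈h = f≈h [] refl
    sumPre-cong-fibre (nothing ∷ β) f≈h =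
      sumPre-cong-fibre β (λ α p → f≈h _ (cong (nothing ∷_) p))
    sumPre-cong-fibre (just b ∷ β)  f≈h = ΣFin-cong q λ g → if-cong (φ g ≟ᶠ b) λ φg≡b →
      sumPre-cong-fibre β (λ α p → f≈h _ (≡.cong₂ _∷_ (cong just φg≡b) p))

    sumPre-cong : ∀ {n} {f h : PA (Fin q) n → Carrier} (β : PA 𝔹 n) →
                  (∀ α → f α ≈ h α) → sumPre φ f β ≈ sumPre φ h β
    sumPre-cong β f≈h = sumPre-cong-fibre β (λ α _ → f≈h α)

    sumPre-zero : ∀ {n} {f : PA (Fin q) n → Carrier} (β : PA 𝔹 n) →
                  (∀ α → relabel φ α ≡ β → f α ≈ 0#) → sumPre φ f β ≈ 0#
    sumPre-zero []            f≈0 = f≈0 [] refl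
    sumPre-zero (nothing ∷ β) f≈0 = sumPre-zero β (λ α p → f≈0 _ (cong (nothing ∷_) p))
    sumPre-zero (just b ∷ β)  f≈0 = ΣFin-zero q λ g → if-zero (φ g ≟ᶠ b) λ φg≡b →
      sumPre-zero β (λ α p → f≈0 _ (≡.cong₂ _∷_ (cong just φg≡b) p))

    sumPre-ΣFin : ∀ {n} r (f : Fin r → PA (Fin q) n → Carrier) (β : PA 𝔹 n) →
                  sumPre φ (λ α → ΣFin r (λ k → f k α)) β ≈
                  ΣFin r (λ k → sumPre φ (f k) β)
    sumPre-ΣFin r f []            = ≈-refl
    sumPre-ΣFin r f (nothing ∷ β) = sumPre-ΣFin r _ β
    sumPre-ΣFin r f (just b ∷ β)  = ≈-trans
      (ΣFin-cong q λ g → ≈-trans (if-cong (φ g ≟ᶠ b) λ _ → sumPre-ΣFin r _ β)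
                                 (if-ΣFin (does (φ g ≟ᶠ b)) r _))
      (ΣFin-comm q r _)

    *-sumPre : ∀ {n} a (f : PA (Fin q) n → Carrier) (β : PA 𝔹 n) →
               a * sumPre φ f β ≈ sumPre φ (λ α → a * f α) β
    *-sumPre a f []            = ≈-refl
    *-sumPre a f (nothing ∷ β) = *-sumPre a _ β
    *-sumPre a f (just b ∷ β)  = ≈-trans (*-ΣFin q a _) (ΣFin-cong q λ g →
      ≈-trans (*-if (does (φ g ≟ᶠ b)) a _) (if-cong (φ g ≟ᶠ b) λ _ → *-sumPre a _ β))

    sumPre-* : ∀ {n} a (f : PA (Fin q) n → Carrier) (β : PA 𝔹 n) →
               sumPre φ f β * a ≈ sumPre φ (λ α → f α * a) β
    sumPre-* a f β =
      ≈-trans (*-comm _ a) (≈-trans (*-sumPre a f β) (sumPre-cong β λ α → *-comm a _))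

    sumPre-if : ∀ {n} b (f : PA (Fin q) n → Carrier) (β : PA 𝔹 n) →
                sumPre φ (λ α → if b then f α else 0#) β ≈ (if b then sumPre φ f β else 0#)
    sumPre-if true  f β = ≈-refl
    sumPre-if false f β = sumPre-zero β (λ _ _ → ≈-refl)

    sumPre-emptyPA : ∀ n (f : PA (Fin q) n → Carrier) → sumPre φ f (emptyPA n) ≡ f (emptyPA n)
    sumPre-emptyPA zero    f = refl
    sumPre-emptyPA (suc n) f = sumPre-emptyPA n _

    sumPre-nonneg : ∀ {n} {f : PA (Fin q) n → Carrier} (β : PA 𝔹 n) →
                    (∀ α → dom α ≡ dom β → 0# ≤ f α) → 0# ≤ sumPre φ f β
    sumPre-nonneg []            0≤f = 0≤f [] refl
    sumPre-nonneg (nothing ∷ β) 0≤f = sumPre-nonneg β (λ α d → 0≤f _ (cong (false ∷_) d))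
    sumPre-nonneg (just b ∷ β)  0≤f = ΣFin-nonneg q λ g →
      if-nonneg (does (φ g ≟ᶠ b)) (sumPre-nonneg β (λ α d → 0≤f _ (cong (true ∷_) d)))

    sumPre≤sumExt : ∀ {n} {f : PA (Fin q) n → Carrier} (β : PA 𝔹 n) →
                    (∀ α → dom α ≡ dom β → 0# ≤ f α) →
                    sumPre φ f β ≤ sumExt f (emptyPA n) (dom β)
    sumPre≤sumExt []            0≤f = ≤-refl
    sumPre≤sumExt (nothing ∷ β) 0≤f = sumPre≤sumExt β (λ α d → 0≤f _ (cong (false ∷_) d))
    sumPre≤sumExt {f = f} (just b ∷ β) 0≤f = ΣFin-mono q λ g → if-≤ (does (φ g ≟ᶠ b))
      (sumPre≤sumExt β (0≤f-tail g)) (sumExt-nonneg (dom β) (0≤f-tail g))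
      where
      0≤f-tail : ∀ g α → dom α ≡ dom β → 0# ≤ f (just g ∷ α)
      0≤f-tail g α d = 0≤f (just g ∷ α) (cong (true ∷_) d)

    ΣFin-fibres : ∀ (f : Fin q → Carrier) →
                  ΣFin 2 (λ b → ΣFin q (λ g → if does (φ g ≟ᶠ b) then f g else 0#)) ≈
                  ΣFin q f
    ΣFin-fibres f = ≈-trans (ΣFin-comm 2 q (λ b g → if does (φ g ≟ᶠ b) then f g else 0#))
                            (ΣFin-cong q oneFibre)
      where
      oneFibre : ∀ g → ΣFin 2 (λ b → if does (φ g ≟ᶠ b) then f g else 0#) ≈ f g
      oneFibre g with φ g
      ... | zero     = ≈-trans (+-cong ≈-refl (+-identityʳ 0#)) (+-identityʳ _)
      ... | suc zero = ≈-trans (+-identityˡ _) (+-identityʳ _)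

    sumExt-sumPre : ∀ {n} (f : PA (Fin q) n → Carrier) (β : PA 𝔹 n) (T : Subset n) →
                    sumExt (sumPre φ f) β T ≈ sumPre φ (λ α → sumExt f α T) β
    sumExt-sumPre-just : ∀ {n} (f : PA (Fin q) (suc n) → Carrier) b
                         (β : PA 𝔹 n) (T : Subset n) →
      sumExt (λ γ → sumPre φ f (just b ∷ γ)) β T ≈
      ΣFin q (λ g → if does (φ g ≟ᶠ b)
                      then sumPre φ (λ α → sumExt (λ γ → f (just g ∷ γ)) α T) β
                      else 0#)

    sumExt-sumPre f []            []          = ≈-refl
    sumExt-sumPre f (just b ∷ β)  (_ ∷ T)     = sumExt-sumPre-just f b β T
    sumExt-sumPre f (nothing ∷ β) (false ∷ T) = sumExt-sumPre _ β T
    sumExt-sumPre f (nothing ∷ β) (true ∷ T)  = begin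
      ΣFin 2 (λ b → sumExt (λ γ → sumPre φ f (just b ∷ γ)) β T)
        ≈⟨ ΣFin-cong 2 (λ b → sumExt-sumPre-just f b β T) ⟩
      ΣFin 2 (λ b → ΣFin q (λ g → if does (φ g ≟ᶠ b)
                                  then sumPre φ (λ α → sumExt (λ γ → f (just g ∷ γ)) α T) β
                                  else 0#))
        ≈⟨ ΣFin-fibres _ ⟩
      ΣFin q (λ g → sumPre φ (λ α → sumExt (λ γ → f (just g ∷ γ)) α T) β)
        ≈⟨ sumPre-ΣFin q _ β ⟨
      sumPre φ (λ α → sumExt f (nothing ∷ α) (true ∷ T)) β
        ∎

    sumExt-sumPre-just f b β T = ≈-trans (sumExt-ΣFin q _ β T) (ΣFin-cong q λ g →
      ≈-trans (sumExt-if (does (φ g ≟ᶠ b)) _ β T)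
              (if-cong (φ g ≟ᶠ b) λ _ → sumExt-sumPre _ β T))

    sumPre-swap : ∀ {m n} (f : PA (Fin q) m → PA (Fin q) n → Carrier)
                  (β : PA 𝔹 m) (β' : PA 𝔹 n) →
                  sumPre φ (λ α → sumPre φ (f α) β') β ≈
                  sumPre φ (λ α' → sumPre φ (λ α → f α α') β) β'
    sumPre-swap f []            β' = ≈-refl
    sumPre-swap f (nothing ∷ β) β' = sumPre-swap _ β β'
    sumPre-swap f (just b ∷ β)  β' = ≈-trans
      (ΣFin-cong q λ g → ≈-trans (if-cong (φ g ≟ᶠ b) λ _ → sumPre-swap _ β β')
                                 (≈-sym (sumPre-if (does (φ g ≟ᶠ b)) _ β')))
      (≈-sym (sumPre-ΣFin q _ β'))

    sumPre-maybe : ∀ {n} {A : Set} (F : A → PA (Fin q) n → Carrier) (m : Maybe A) (γ : PA 𝔹 n) →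
                   sumPre φ (λ δ → maybe′ (λ w → F w δ) 0# m) γ ≈
                   maybe′ (λ w → sumPre φ (F w) γ) 0# m
    sumPre-maybe F nothing  γ = sumPre-zero γ (λ _ _ → ≈-refl)
    sumPre-maybe F (just w) γ = ≈-refl

    sumPre₁ : Maybe 𝔹 → (Maybe (Fin q) → Carrier) → Carrier
    sumPre₁ x k = sumPre φ (k ∘ head) (x ∷ [])

    sumPre₁-cong : ∀ x {k k' : Maybe (Fin q) → Carrier} → (∀ h → k h ≈ k' h) →
                   sumPre₁ x k ≈ sumPre₁ x k'
    sumPre₁-cong x k≈k' = sumPre-cong (x ∷ []) (k≈k' ∘ head)

    sumPre-∷ : ∀ {n} x (f : PA (Fin q) (suc n) → Carrier) (β : PA 𝔹 n) →
               sumPre φ f (x ∷ β) ≡ sumPre₁ x (λ h → sumPre φ (λ α → f (h ∷ α)) β)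
    sumPre-∷ nothing  f β = refl
    sumPre-∷ (just b) f β = refl

    sumPre₁-mergeHead : ∀ (k : Maybe (Fin q) → Carrier) x y →
      sumPre₁ x (λ h → sumPre₁ y (λ h' → maybe′ k 0# (mergeHead h h'))) ≈
      maybe′ (λ w → sumPre₁ w k) 0# (mergeHead x y)
    sumPre₁-mergeHead k nothing  y        = ≈-refl
    sumPre₁-mergeHead k (just b) nothing  = ≈-refl
    sumPre₁-mergeHead k (just b) (just b') with b ≟ᶠ b'
    ... | yes refl = ΣFin-cong q λ g → if-cong (φ g ≟ᶠ b) λ φg≡b → ≈-trans
          (ΣFin-single q g λ g' g'≢g → if-zero (φ g' ≟ᶠ b) λ _ →
            ≈-reflexive (cong (maybe′ k 0#) (mergeHead-≢ (g'≢g ∘ ≡.sym))))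
          (≈-trans (if-yes (φ g ≟ᶠ b) φg≡b)
                   (≈-reflexive (cong (maybe′ k 0#) (mergeHead-≡ g))))
    ... | no b≢b' =
          ΣFin-zero q λ g → if-zero (φ g ≟ᶠ b) λ φg≡b →
          ΣFin-zero q λ g' → if-zero (φ g' ≟ᶠ b') λ φg'≡b' →
          ≈-reflexive (cong (maybe′ k 0#) (mergeHead-≢ λ g≡g' →
            b≢b' (≡.trans (≡.sym φg≡b) (≡.trans (cong φ g≡g') φg'≡b'))))

    sumPre-∷² : ∀ {m n} (f : PA (Fin q) (suc m) → PA (Fin q) (suc n) → Carrier) x y
                  (β : PA 𝔹 m) (β' : PA 𝔹 n) →
      sumPre φ (λ α → sumPre φ (f α) (y ∷ β')) (x ∷ β) ≈
      sumPre₁ x (λ h → sumPre₁ y (λ h' →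
        sumPre φ (λ α → sumPre φ (λ α' → f (h ∷ α) (h' ∷ α')) β') β))
    sumPre-∷² {m} f x y β β' = begin
      sumPre φ (λ α → sumPre φ (f α) (y ∷ β')) (x ∷ β)
        ≡⟨ sumPre-∷ x _ β ⟩
      sumPre₁ x (λ h → sumPre φ (λ α → sumPre φ (f (h ∷ α)) (y ∷ β')) β)
        ≈⟨ sumPre₁-cong x (λ h → sumPre-cong β λ α →
             ≈-reflexive (sumPre-∷ y (f (h ∷ α)) β')) ⟩
      sumPre₁ x (λ h → sumPre φ (λ α → sumPre₁ y (λ h' → tails h α h')) β)
        ≈⟨ sumPre₁-cong x (λ h → sumPre-swap (λ α a → tails h α (head a)) β (y ∷ [])) ⟩
      sumPre₁ x (λ h → sumPre₁ y (λ h' → sumPre φ (λ α → tails h α h') β))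
        ∎
      where
      tails : Maybe (Fin q) → PA (Fin q) m → Maybe (Fin q) → Carrier
      tails h α h' = sumPre φ (λ α' → f (h ∷ α) (h' ∷ α')) β'

    sumPre-mergeHead : ∀ {n} (F : PA (Fin q) (suc n) → Carrier) x y (γ : PA 𝔹 n) →
      sumPre₁ x (λ h → sumPre₁ y (λ h' →
        sumPre φ (λ δ → maybe′ (λ w → F (w ∷ δ)) 0# (mergeHead h h')) γ)) ≈
      maybe′ (λ w → sumPre φ F (w ∷ γ)) 0# (mergeHead x y)
    sumPre-mergeHead F x y γ = begin
      sumPre₁ x (λ h → sumPre₁ y (λ h' →
        sumPre φ (λ δ → maybe′ (λ w → F (w ∷ δ)) 0# (mergeHead h h')) γ))
        ≈⟨ sumPre₁-cong x (λ h → sumPre₁-cong y λ h' →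
             sumPre-maybe (λ w δ → F (w ∷ δ)) (mergeHead h h') γ) ⟩
      sumPre₁ x (λ h → sumPre₁ y (λ h' → maybe′ Fγ 0# (mergeHead h h')))
        ≈⟨ sumPre₁-mergeHead Fγ x y ⟩
      maybe′ (λ w → sumPre₁ w Fγ) 0# (mergeHead x y)
        ≈⟨ maybe-cong (mergeHead x y) (λ w → ≈-reflexive (sumPre-∷ w F γ)) ⟨
      maybe′ (λ w → sumPre φ F (w ∷ γ)) 0# (mergeHead x y)
        ∎
      where
      Fγ : Maybe (Fin q) → Carrier
      Fγ w = sumPre φ (λ δ → F (w ∷ δ)) γ

    sumPre-merge : ∀ {n} (F : PA (Fin q) n → Carrier) (β β' : PA 𝔹 n) →
      sumPre φ (λ α → sumPre φ (λ α' → maybe′ F 0# (merge α α')) β') β ≈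
      maybe′ (sumPre φ F) 0# (merge β β')
    sumPre-merge F []      []       = ≈-refl
    sumPre-merge F (x ∷ β) (y ∷ β') = begin
      sumPre φ (λ α → sumPre φ (λ α' → maybe′ F 0# (merge α α')) (y ∷ β')) (x ∷ β)
        ≈⟨ sumPre-∷² (λ α α' → maybe′ F 0# (merge α α')) x y β β' ⟩
      sumPre₁ x (λ h → sumPre₁ y (λ h' →
        sumPre φ (λ α → sumPre φ (λ α' → maybe′ F 0# (merge (h ∷ α) (h' ∷ α'))) β') β))
        ≈⟨ sumPre₁-cong x (λ h → sumPre₁-cong y λ h' →
             sumPre-cong β λ α → sumPre-cong β' λ α' → ≈-reflexive (maybe-merge-∷ F 0# h h' α α')) ⟩
      sumPre₁ x (λ h → sumPre₁ y (λ h' →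
        sumPre φ (λ α → sumPre φ (λ α' → maybe′ (headMerged h h') 0# (merge α α')) β') β))
        ≈⟨ sumPre₁-cong x (λ h → sumPre₁-cong y λ h' →
             sumPre-merge (headMerged h h') β β') ⟩
      sumPre₁ x (λ h → sumPre₁ y (λ h' → maybe′ (sumPre φ (headMerged h h')) 0# (merge β β')))
        ≈⟨ onTails (merge β β') ⟩
      maybe′ (λ γ → maybe′ (λ w → sumPre φ F (w ∷ γ)) 0# (mergeHead x y)) 0# (merge β β')
        ≡⟨ maybe-merge-∷ (sumPre φ F) 0# x y β β' ⟨
      maybe′ (sumPre φ F) 0# (merge (x ∷ β) (y ∷ β'))
        ∎
      where
      headMerged : Maybe (Fin q) → Maybe (Fin q) → PA (Fin q) _ → Carrier
      headMerged h h' γ = maybe′ (λ w → F (w ∷ γ)) 0# (mergeHead h h')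

      onTails : ∀ m →
        sumPre₁ x (λ h → sumPre₁ y (λ h' → maybe′ (sumPre φ (headMerged h h')) 0# m)) ≈
        maybe′ (λ γ → maybe′ (λ w → sumPre φ F (w ∷ γ)) 0# (mergeHead x y)) 0# m
      onTails nothing  = sumPre-zero (x ∷ []) (λ _ _ → sumPre-zero (y ∷ []) (λ _ _ → ≈-refl))
      onTails (just γ) = sumPre-mergeHead F x y γ

    sumPre-single : ∀ {n} (f : PA (Fin q) n → Carrier) (v : Fin n) b →
      sumPre φ f (single v b) ≈ ΣFin q (λ g → if does (φ g ≟ᶠ b) then f (single v g) else 0#)
    sumPre-single {suc n} f zero    b = ΣFin-cong q λ g → if-cong (φ g ≟ᶠ b) λ _ →
      ≈-reflexive (sumPre-emptyPA n (λ α → f (just g ∷ α)))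
    sumPre-single {suc n} f (suc v) b = sumPre-single (λ α → f (nothing ∷ α)) v b

    pushX-localDist : ∀ {n t} {X' : PA (Fin q) n → Carrier} →
                      LocalDist q n t X' → LocalDist 2 n t (pushX φ X')
    pushX-localDist {n} {t} {X'} D = record
      { empty   = ≈-trans (≈-reflexive (sumPre-emptyPA n X')) (LocalDist.empty D)
      ; range   = λ β |β|≤t →
          sumPre-nonneg β (nonneg |β|≤t) ,
          ≲-respʳ-≈ (≈-trans (total |β|≤t) (LocalDist.empty D))
                    (sumPre≤sumExt β (nonneg |β|≤t))
      ; consist = λ β T β⊆T |T|≤t →
          ≈-trans (sumExt-sumPre X' β T) (sumPre-cong-fibre β λ α α↦β →
            LocalDist.consist D α T (subst (_⊆ T) (≡.sym (dom-fibre φ α α↦β)) β⊆T) |T|≤t)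
      }
      where
      nonneg : ∀ {β : PA 𝔹 n} → size β ℕ.≤ t → ∀ α → dom α ≡ dom β → 0# ≤ X' α
      nonneg |β|≤t α d =
        proj₁ (LocalDist.range D α (subst (ℕ._≤ t) (cong ∣_∣ (≡.sym d)) |β|≤t))

      total : ∀ {β : PA 𝔹 n} → size β ℕ.≤ t →
              sumExt X' (emptyPA n) (dom β) ≈ X' (emptyPA n)
      total {β} = LocalDist.consist D (emptyPA n) (dom β) (dom-emptyPA-⊆ n (dom β))

    pushX-satisfies : ∀ {n} (𝒫 : PredFamily 𝔹) {X' : PA (Fin q) n → Carrier} C →
                      Satisfies (liftFamily φ 𝒫) X' C → Satisfies 𝒫 (pushX φ X') C
    pushX-satisfies 𝒫 {X'} (constraint i E distinct) sat bs ¬P =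
      sumPre-zero (assign E bs) λ α α↦bs →
        let (as , α≡as , φas≡bs) = relabel≡assign φ E distinct α bs α↦bs
        in ≈-trans (≈-reflexive (cong X' α≡as))
                   (sat as (¬P ∘ subst (PredFamily.pred 𝒫 i) φas≡bs))

    pushX-satisfiesAll : ∀ {n} (𝒫 : PredFamily 𝔹) {X' : PA (Fin q) n → Carrier}
                         {𝒞 : Instance 𝒫 n} → SatisfiesAll (liftFamily φ 𝒫) X' 𝒞 →
                         SatisfiesAll 𝒫 (pushX φ X') 𝒞
    pushX-satisfiesAll 𝒫 {X'} = All.map λ {C} → pushX-satisfies 𝒫 {X'} C

    pushV-gram : ∀ {n N t} (V' : PA (Fin q) n → Fin N → Carrier) (X' : PA (Fin q) n → Carrier) →
                 Gram t V' X' → Gram t (pushV φ V') (pushX φ X')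
    pushV-gram {n} {N} {t} V' X' gram β β' |β|≤t |β'|≤t = begin
      ΣFin N (λ i → sumPre φ (λ α → V' α i) β * sumPre φ (λ α' → V' α' i) β')
        ≈⟨ ΣFin-cong N (λ i →
             ≈-trans (sumPre-* _ _ β) (sumPre-cong β λ α → *-sumPre _ _ β')) ⟩
      ΣFin N (λ i → sumPre φ (λ α → sumPre φ (λ α' → V' α i * V' α' i) β') β)
        ≈⟨ ≈-trans (sumPre-cong β λ α → sumPre-ΣFin N _ β') (sumPre-ΣFin N _ β) ⟨
      sumPre φ (λ α → sumPre φ (λ α' → V' α · V' α') β') β
        ≈⟨ sumPre-cong-fibre β (λ α α↦β → sumPre-cong-fibre β' λ α' α'↦β' →
             gram α α' (fibre-size α α↦β |β|≤t) (fibre-size α' α'↦β' |β'|≤t)) ⟩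
      sumPre φ (λ α → sumPre φ (λ α' → maybe′ X' 0# (merge α α')) β') β
        ≈⟨ sumPre-merge X' β β' ⟩
      maybe′ (sumPre φ X') 0# (merge β β')
        ∎
      where
      fibre-size : ∀ α {γ} → relabel φ α ≡ γ → size γ ℕ.≤ t → size α ℕ.≤ t
      fibre-size α α↦γ = subst (ℕ._≤ t) (cong ∣_∣ (≡.sym (dom-fibre φ α α↦γ)))

    pushX-invBiased : ∀ {n} {X' : PA (Fin q) n → Carrier} → UniqueOne φ → Balanced X' →
                      InvBiased q (pushX φ X')
    pushX-invBiased {X' = X'} (g₁ , φg₁≡1 , unique) balanced v = ≈-trans
      (*-cong ≈-refl (begin
        sumPre φ X' (single v one)
          ≈⟨ sumPre-single X' v one ⟩
        ΣFin q (λ g → if does (φ g ≟ᶠ one) then X' (single v g) else 0#)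
          ≈⟨ ΣFin-single q g₁ (λ g g≢g₁ →
               if-zero (φ g ≟ᶠ one) (⊥-elim ∘ g≢g₁ ∘ unique g)) ⟩
        (if does (φ g₁ ≟ᶠ one) then X' (single v g₁) else 0#)
          ≈⟨ if-yes (φ g₁ ≟ᶠ one) φg₁≡1 ⟩
        X' (single v g₁)
          ∎))
      (balanced v g₁)

lemma1 : ∀ {c ℓ} (𝓡 : OrderedCommRing c ℓ) (𝒫 : PredFamily 𝔹)
    (q : ℕ) (φ : Fin q → 𝔹) → UniqueOne φ →
    (n : ℕ) (𝒞 : Instance 𝒫 n) (t : ℕ) →
    let open Hier 𝓡 in
    (∀ X' → SASolution (liftFamily φ 𝒫) 𝒞 t X' →
    SASolution 𝒫 𝒞 t (pushX φ X')
    × (Balanced X' → InvBiased q (pushX φ X')))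
    × (∀ {N} V' X' → LasserreSolution {N = N} (liftFamily φ 𝒫) 𝒞 t V' X' →
    LasserreSolution 𝒫 𝒞 t (pushV φ V') (pushX φ X')
    × (Balanced X' → InvBiased q (pushX φ X')))
lemma1 𝓡 𝒫 q φ uniqueOne n 𝒞 t =
    (λ X' (D , sat) →
      (pushX-localDist 𝓡 φ D , pushX-satisfiesAll 𝓡 φ 𝒫 sat)
      , pushX-invBiased 𝓡 φ uniqueOne)
  , (λ V' X' (D , gram , sat) →
      (pushX-localDist 𝓡 φ D , pushV-gram 𝓡 φ V' X' gram , pushX-satisfiesAll 𝓡 φ 𝒫 sat)
      , pushX-invBiased 𝓡 φ uniqueOne)
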